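{- For every integer $n \geq 4$, $$x_n = \begin{cases} x_{n - 1} + x_{n - 2} - x_{n - 3} + 1, & \text{if } n = 3 \cdot 2^i \text{ or } n = 3 \cdot 2^i + 1 \text{ for some integer } i \geq 0,\\ x_{n - 1} + x_{n - 2} - x_{n - 3}, & \text{otherwise.}\end{cases}$$
   Context: The sequence $(x_n)_{n\ge1}$ is defined by $x_1 = 0, x_2 = 1, x_3 = 2, x_4 = 4, x_5 = 5$ and, for $n \geq 6$, $$x_n = (n - 1) + \begin{cases} x_{\frac{n + 1}{2}} + x_{\frac{n - 3}{2}}, & n \equiv 1 \pmod 4,\\ 2 x_{\frac{n - 1}{2}}, & n \equiv 3 \pmod 4,\\ x_{\frac{n}{2}} + x_{\frac{n - 2}{2}}, & n \text{ even}. \end{cases}$$ -}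

module Defs where

open import Data.Nat using (ℕ; zero; suc; _+_; _*_; _∸_; _^_; _/_; _%_)

-- For n ≥ 6 all recursive
-- indices are < n, so fuel (suc n) is always sufficient; with
-- insufficient fuel the value 0 is returned (never happens for x below).
xf : ℕ → ℕ → ℕ
xf zero _ = 0
xf (suc f) 0 = 0              -- unused index (sequence starts at 1)
xf (suc f) 1 = 0
xf (suc f) 2 = 1
xf (suc f) 3 = 2
xf (suc f) 4 = 4
xf (suc f) 5 = 5
xf (suc f) n@(suc (suc (suc (suc (suc (suc _)))))) with n % 4
... | 1 = (n ∸ 1) + (xf f ((n + 1) / 2) + xf f ((n ∸ 3) / 2))
... | 3 = (n ∸ 1) + (2 * xf f ((n ∸ 1) / 2))
... | _ = (n ∸ 1) + (xf f (n / 2) + xf f ((n ∸ 2) / 2))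

x : ℕ → ℕ
x n = xf (suc n) n

-- Write D n = x n − x (n − 1) − x (n − 2) + x (n − 3).  Unfolding the
-- recurrence at n = 4k, 4k + 1, 4k + 2, 4k + 3 (k ≥ 3), the linear terms
-- n − 1 cancel and one finds D (4k) = D (2k), D (4k + 1) = D (2k + 1) and
-- D (4k + 2) = D (4k + 3) = 0.  The set of numbers 3·2^i and 3·2^i + 1 obeys
-- the same rules: halving preserves 3·2^i, and a parity argument rules out
-- 4k + 2 and 4k + 3.  Strong induction from the cases 4 ≤ n < 12 finishes.
module Submission where

open import Defs
open import Data.Nat using (ℕ; _≤_; _∸_; _*_; _^_; _+_)
open import Data.Integer using (ℤ; +_) renaming (_+_ to _+ℤ_; _-_ to _-ℤ_)
open import Data.Product using (∃-syntax; _×_)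
open import Data.Sum using (_⊎_)
open import Relation.Binary.PropositionalEquality using (_≡_)
open import Relation.Nullary using (¬_)

open import Data.Nat using (zero; suc; _<_; _/_; _%_; s≤s; z≤n)
open import Data.Nat.Properties
open import Data.Nat.DivMod using (m<n*o⇒m/o<n; m*n/n≡m; [m+kn]%n≡m%n)
open import Data.Nat.Induction using (<-rec)
open import Data.Nat.Tactic.RingSolver using (solve)
open import Data.List.Base using (_∷_; [])
open import Data.Product using (_,_)
open import Data.Sum using (inj₁; inj₂)
open import Function.Bundles using (_⇔_; mk⇔; Equivalence)
import Function.Properties.Equivalence as ⇔
open import Relation.Binary.PropositionalEquality
  using (_≢_; refl; sym; trans; cong; cong₂; module ≡-Reasoning)
open import Relation.Nullary using (contradiction)
open import Function.Base using (_∘_)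
import Data.Integer.Properties as ℤ
import Data.Integer.Tactic.RingSolver as ℤ-Solver

open Equivalence using (to; from)
open ≡-Reasoning

m*2≢1+n*2 : ∀ m n → m * 2 ≢ 1 + n * 2
m*2≢1+n*2 m n eq = even≢odd m n (trans (*-comm 2 m) (trans eq (cong suc (*-comm n 2))))

half : ∀ m → m * 2 / 2 ≡ m
half m = m*n/n≡m m 2

n+1<n*2 : ∀ {n} → 2 ≤ n → n + 1 < n * 2
n+1<n*2 {n} 2≤n = <-≤-trans {n + 1} {n + n} (+-monoʳ-< n 2≤n) (≤-reflexive (solve (n ∷ [])))

half-< : ∀ {a n} → 2 ≤ n → a ≤ n + 1 → a / 2 < n
half-< {a} {n} 2≤n a≤n+1 = m<n*o⇒m/o<n {a} {n} {2} (≤-<-trans a≤n+1 (n+1<n*2 2≤n))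

-- Writing 4m as m * 2 * 2 makes halving and the passage m ↦ suc m definitional.
%4-of-multiple : ∀ r m → (r + m * 2 * 2) % 4 ≡ r % 4
%4-of-multiple r m = trans (cong (λ q → (r + q) % 4) (*-assoc m 2 2)) ([m+kn]%n≡m%n r m 4)

n∸k≤n+1 : ∀ n k → n ∸ k ≤ n + 1
n∸k≤n+1 n k = ≤-trans (m∸n≤m n k) (m≤m+n n 1)

xf-fuel-irrelevant : ∀ {f g} n → n < f → n < g → xf f n ≡ xf g n

xf-fuel-irrelevant/2 : ∀ {f g n} → 2 ≤ n → n ≤ f → n ≤ g → ∀ a → a ≤ n + 1 → xf f (a / 2) ≡ xf g (a / 2)
xf-fuel-irrelevant/2 2≤n n≤f n≤g a a≤ =
  xf-fuel-irrelevant (a / 2) (<-≤-trans (half-< 2≤n a≤) n≤f) (<-≤-trans (half-< 2≤n a≤) n≤g)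

xf-fuel-irrelevant {suc f} {suc g} 0 _ _ = refl
xf-fuel-irrelevant {suc f} {suc g} 1 _ _ = refl
xf-fuel-irrelevant {suc f} {suc g} 2 _ _ = refl
xf-fuel-irrelevant {suc f} {suc g} 3 _ _ = refl
xf-fuel-irrelevant {suc f} {suc g} 4 _ _ = refl
xf-fuel-irrelevant {suc f} {suc g} 5 _ _ = refl
xf-fuel-irrelevant {suc f} {suc g} n@(suc (suc (suc (suc (suc (suc _)))))) (s≤s n≤f) (s≤s n≤g)
  with n % 4 | xf-fuel-irrelevant/2 (s≤s (s≤s z≤n)) n≤f n≤g
... | 1 | fuel = cong (_+_ (n ∸ 1)) (cong₂ _+_ (fuel (n + 1) ≤-refl) (fuel (n ∸ 3) (n∸k≤n+1 n 3)))
... | 3 | fuel = cong (λ y → n ∸ 1 + 2 * y) (fuel (n ∸ 1) (n∸k≤n+1 n 1))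
... | 0 | fuel = cong (_+_ (n ∸ 1)) (cong₂ _+_ (fuel n (n∸k≤n+1 n 0)) (fuel (n ∸ 2) (n∸k≤n+1 n 2)))
... | 2 | fuel = cong (_+_ (n ∸ 1)) (cong₂ _+_ (fuel n (n∸k≤n+1 n 0)) (fuel (n ∸ 2) (n∸k≤n+1 n 2)))
... | suc (suc (suc (suc _))) | fuel =
  cong (_+_ (n ∸ 1)) (cong₂ _+_ (fuel n (n∸k≤n+1 n 0)) (fuel (n ∸ 2) (n∸k≤n+1 n 2)))

xf-half≡x : ∀ {n a′ a} → 2 ≤ n → a′ ≤ n + 1 → a′ / 2 ≡ a → xf n (a′ / 2) ≡ x a
xf-half≡x {a′ = a′} 2≤n a′≤ eq =
  trans (xf-fuel-irrelevant (a′ / 2) (half-< 2≤n a′≤) ≤-refl) (cong x eq)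

module _ {t : ℕ} where

  private
    2≤ : 2 ≤ 6 + t
    2≤ = s≤s (s≤s z≤n)

    below : ∀ k → 6 + t ∸ k ≤ 6 + t + 1
    below = n∸k≤n+1 (6 + t)

  x-rec₁ : ∀ {a b} → (6 + t) % 4 ≡ 1 → (6 + t + 1) / 2 ≡ a → (6 + t ∸ 3) / 2 ≡ b →
           x (6 + t) ≡ 6 + t ∸ 1 + (x a + x b)
  x-rec₁ r ha hb rewrite r =
    cong (_+_ (6 + t ∸ 1)) (cong₂ _+_ (xf-half≡x 2≤ ≤-refl ha) (xf-half≡x 2≤ (below 3) hb))

  x-rec₃ : ∀ {a} → (6 + t) % 4 ≡ 3 → (6 + t ∸ 1) / 2 ≡ a → x (6 + t) ≡ 6 + t ∸ 1 + 2 * x a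
  x-rec₃ r ha rewrite r = cong (λ y → 6 + t ∸ 1 + 2 * y) (xf-half≡x 2≤ (below 1) ha)

  x-rec-even : ∀ {a b} → (6 + t) % 4 ≡ 0 ⊎ (6 + t) % 4 ≡ 2 →
               (6 + t) / 2 ≡ a → (6 + t ∸ 2) / 2 ≡ b → x (6 + t) ≡ 6 + t ∸ 1 + (x a + x b)
  x-rec-even (inj₁ r) ha hb rewrite r =
    cong (_+_ (6 + t ∸ 1)) (cong₂ _+_ (xf-half≡x 2≤ (below 0) ha) (xf-half≡x 2≤ (below 2) hb))
  x-rec-even (inj₂ r) ha hb rewrite r =
    cong (_+_ (6 + t ∸ 1)) (cong₂ _+_ (xf-half≡x 2≤ (below 0) ha) (xf-half≡x 2≤ (below 2) hb))

x-4k : ∀ m → x (8 + m * 2 * 2) ≡ 7 + m * 2 * 2 + (x (4 + m * 2) + x (3 + m * 2))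
x-4k m = x-rec-even {2 + m * 2 * 2} (inj₁ (%4-of-multiple 8 m)) (half (4 + m * 2)) (half (3 + m * 2))

x-4k+1 : ∀ m → x (9 + m * 2 * 2) ≡ 8 + m * 2 * 2 + (x (5 + m * 2) + x (3 + m * 2))
x-4k+1 m = x-rec₁ {3 + m * 2 * 2} (%4-of-multiple 9 m)
  (trans (cong (_/ 2) (+-comm (9 + m * 2 * 2) 1)) (half (5 + m * 2))) (half (3 + m * 2))

x-4k+2 : ∀ m → x (6 + m * 2 * 2) ≡ 5 + m * 2 * 2 + (x (3 + m * 2) + x (2 + m * 2))
x-4k+2 m = x-rec-even {m * 2 * 2} (inj₂ (%4-of-multiple 6 m)) (half (3 + m * 2)) (half (2 + m * 2))

x-4k+3 : ∀ m → x (7 + m * 2 * 2) ≡ 6 + m * 2 * 2 + 2 * x (3 + m * 2)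
x-4k+3 m = x-rec₃ {1 + m * 2 * 2} (%4-of-multiple 7 m) (half (3 + m * 2))

-- x n − x (n − 1) − x (n − 2) + x (n − 3) ≡ c, with the negative terms
-- moved to the right so that no truncated subtraction occurs.
Defect : ℕ → ℕ → Set
Defect n c = x n + x (n ∸ 3) ≡ x (n ∸ 1) + x (n ∸ 2) + c

defect-4k : ∀ m {c} → Defect (6 + m * 2) c → Defect (12 + m * 2 * 2) c
defect-4k m {c} h = begin
  x (12 + q) + x (9 + q)                   ≡⟨ cong₂ _+_ (x-4k (suc m)) (x-4k+1 m) ⟩
  (11 + q + (a + b)) + (8 + q + (b + d))   ≡⟨ regroup q a b d e c h ⟩
  (10 + q + 2 * b) + (9 + q + (b + e)) + c
    ≡⟨ cong (_+ c) (cong₂ _+_ (x-4k+3 (suc m)) (x-4k+2 (suc m))) ⟨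
  x (11 + q) + x (10 + q) + c              ∎
  where
  q a b d e : ℕ
  q = m * 2 * 2
  a = x (6 + m * 2)
  b = x (5 + m * 2)
  d = x (3 + m * 2)
  e = x (4 + m * 2)
  regroup : ∀ q a b d e c → a + d ≡ b + e + c →
            (11 + q + (a + b)) + (8 + q + (b + d)) ≡ (10 + q + 2 * b) + (9 + q + (b + e)) + c
  regroup q a b d e c h = begin
    (11 + q + (a + b)) + (8 + q + (b + d))   ≡⟨ solve (q ∷ a ∷ b ∷ d ∷ []) ⟩
    19 + 2 * q + 2 * b + (a + d)             ≡⟨ cong (_+_ (19 + 2 * q + 2 * b)) h ⟩
    19 + 2 * q + 2 * b + (b + e + c)         ≡⟨ solve (q ∷ b ∷ e ∷ c ∷ []) ⟩
    (10 + q + 2 * b) + (9 + q + (b + e)) + c ∎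

defect-4k+1 : ∀ m {c} → Defect (7 + m * 2) c → Defect (13 + m * 2 * 2) c
defect-4k+1 m {c} h = begin
  x (13 + q) + x (10 + q)                   ≡⟨ cong₂ _+_ (x-4k+1 (suc m)) (x-4k+2 (suc m)) ⟩
  (12 + q + (a + b)) + (9 + q + (b + e))    ≡⟨ regroup q a b d e c h ⟩
  (11 + q + (d + b)) + (10 + q + 2 * b) + c
    ≡⟨ cong (_+ c) (cong₂ _+_ (x-4k (suc m)) (x-4k+3 (suc m))) ⟨
  x (12 + q) + x (11 + q) + c               ∎
  where
  q a b d e : ℕ
  q = m * 2 * 2
  a = x (7 + m * 2)
  b = x (5 + m * 2)
  d = x (6 + m * 2)
  e = x (4 + m * 2)
  regroup : ∀ q a b d e c → a + e ≡ d + b + c →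
            (12 + q + (a + b)) + (9 + q + (b + e)) ≡ (11 + q + (d + b)) + (10 + q + 2 * b) + c
  regroup q a b d e c h = begin
    (12 + q + (a + b)) + (9 + q + (b + e))    ≡⟨ solve (q ∷ a ∷ b ∷ e ∷ []) ⟩
    21 + 2 * q + 2 * b + (a + e)              ≡⟨ cong (_+_ (21 + 2 * q + 2 * b)) h ⟩
    21 + 2 * q + 2 * b + (d + b + c)          ≡⟨ solve (q ∷ b ∷ d ∷ c ∷ []) ⟩
    (11 + q + (d + b)) + (10 + q + 2 * b) + c ∎

defect-4k+2 : ∀ m → Defect (14 + m * 2 * 2) 0
defect-4k+2 m = begin
  x (14 + q) + x (11 + q)                   ≡⟨ cong₂ _+_ (x-4k+2 (2 + m)) (x-4k+3 (suc m)) ⟩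
  (13 + q + (a + d)) + (10 + q + 2 * b)     ≡⟨ regroup q a b d ⟩
  (12 + q + (a + b)) + (11 + q + (d + b)) + 0
    ≡⟨ cong (_+ 0) (cong₂ _+_ (x-4k+1 (suc m)) (x-4k (suc m))) ⟨
  x (13 + q) + x (12 + q) + 0               ∎
  where
  q a b d : ℕ
  q = m * 2 * 2
  a = x (7 + m * 2)
  b = x (5 + m * 2)
  d = x (6 + m * 2)
  regroup : ∀ q a b d →
            (13 + q + (a + d)) + (10 + q + 2 * b) ≡ (12 + q + (a + b)) + (11 + q + (d + b)) + 0
  regroup q a b d = solve (q ∷ a ∷ b ∷ d ∷ [])

defect-4k+3 : ∀ m → Defect (15 + m * 2 * 2) 0
defect-4k+3 m = begin
  x (15 + q) + x (12 + q)                   ≡⟨ cong₂ _+_ (x-4k+3 (2 + m)) (x-4k (suc m)) ⟩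
  (14 + q + 2 * a) + (11 + q + (d + b))     ≡⟨ regroup q a b d ⟩
  (13 + q + (a + d)) + (12 + q + (a + b)) + 0
    ≡⟨ cong (_+ 0) (cong₂ _+_ (x-4k+2 (2 + m)) (x-4k+1 (suc m))) ⟨
  x (14 + q) + x (13 + q) + 0               ∎
  where
  q a b d : ℕ
  q = m * 2 * 2
  a = x (7 + m * 2)
  b = x (5 + m * 2)
  d = x (6 + m * 2)
  regroup : ∀ q a b d →
            (14 + q + 2 * a) + (11 + q + (d + b)) ≡ (13 + q + (a + d)) + (12 + q + (a + b)) + 0
  regroup q a b d = solve (q ∷ a ∷ b ∷ d ∷ [])

TriplePow2 : ℕ → Set
TriplePow2 n = ∃[ i ] n ≡ 3 * 2 ^ i

Exceptional : ℕ → Set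
Exceptional n = ∃[ i ] (n ≡ 3 * 2 ^ i ⊎ n ≡ 3 * 2 ^ i + 1)

3*2^[1+i]≡3*2^i*2 : ∀ i → 3 * 2 ^ suc i ≡ 3 * 2 ^ i * 2
3*2^[1+i]≡3*2^i*2 i = trans (cong (3 *_) (*-comm 2 (2 ^ i))) (sym (*-assoc 3 (2 ^ i) 2))

triplePow2-*2⇔ : ∀ n → TriplePow2 (n * 2) ⇔ TriplePow2 n
triplePow2-*2⇔ n = mk⇔ ⇒ ⇐
  where
  ⇒ : TriplePow2 (n * 2) → TriplePow2 n
  ⇒ (zero , eq)  = contradiction eq (m*2≢1+n*2 n 1)
  ⇒ (suc i , eq) = i , *-cancelʳ-≡ n (3 * 2 ^ i) 2 (trans eq (3*2^[1+i]≡3*2^i*2 i))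
  ⇐ : TriplePow2 n → TriplePow2 (n * 2)
  ⇐ (i , eq) = suc i , trans (cong (_* 2) eq) (sym (3*2^[1+i]≡3*2^i*2 i))

triplePow2-odd : ∀ k → TriplePow2 (1 + k * 2) → k ≡ 1
triplePow2-odd k (zero , eq)  = *-cancelʳ-≡ k 1 2 (suc-injective eq)
triplePow2-odd k (suc i , eq) =
  contradiction (sym (trans eq (3*2^[1+i]≡3*2^i*2 i))) (m*2≢1+n*2 (3 * 2 ^ i) k)

¬triplePow2-4 : ¬ TriplePow2 4
¬triplePow2-4 = (λ ()) ∘ triplePow2-odd 0 ∘ to (triplePow2-*2⇔ 1) ∘ to (triplePow2-*2⇔ 2)

exceptional⇔triplePow2-even : ∀ {k} → k ≢ 2 → Exceptional (k * 2) ⇔ TriplePow2 (k * 2)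
exceptional⇔triplePow2-even {k} k≢2 = mk⇔ ⇒ ⇐
  where
  ⇒ : Exceptional (k * 2) → TriplePow2 (k * 2)
  ⇒ (i , inj₁ eq)     = i , eq
  ⇒ (zero , inj₂ eq)  = contradiction (*-cancelʳ-≡ k 2 2 eq) k≢2
  ⇒ (suc i , inj₂ eq) = contradiction
    (trans eq (trans (+-comm _ 1) (cong suc (3*2^[1+i]≡3*2^i*2 i)))) (m*2≢1+n*2 k (3 * 2 ^ i))
  ⇐ : TriplePow2 (k * 2) → Exceptional (k * 2)
  ⇐ (i , eq) = i , inj₁ eq

exceptional⇔triplePow2-odd : ∀ {k} → k ≢ 1 → Exceptional (1 + k * 2) ⇔ TriplePow2 (k * 2)
exceptional⇔triplePow2-odd {k} k≢1 = mk⇔ ⇒ ⇐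
  where
  ⇒ : Exceptional (1 + k * 2) → TriplePow2 (k * 2)
  ⇒ (i , inj₁ eq) = contradiction (triplePow2-odd k (i , eq)) k≢1
  ⇒ (i , inj₂ eq) = i , suc-injective (trans eq (+-comm _ 1))
  ⇐ : TriplePow2 (k * 2) → Exceptional (1 + k * 2)
  ⇐ (i , eq) = i , inj₂ (trans (cong suc eq) (+-comm 1 _))

exceptional-4k : ∀ {k} → k ≢ 1 → k ≢ 2 → Exceptional (k * 2 * 2) ⇔ Exceptional (k * 2)
exceptional-4k {k} k≢1 k≢2 =
  ⇔.trans (exceptional⇔triplePow2-even (k≢1 ∘ *-cancelʳ-≡ k 1 2))
  (⇔.trans (triplePow2-*2⇔ (k * 2)) (⇔.sym (exceptional⇔triplePow2-even k≢2)))

exceptional-4k+1 : ∀ {k} → k ≢ 1 → Exceptional (1 + k * 2 * 2) ⇔ Exceptional (1 + k * 2)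
exceptional-4k+1 {k} k≢1 =
  ⇔.trans (exceptional⇔triplePow2-odd (m*2≢1+n*2 k 0))
  (⇔.trans (triplePow2-*2⇔ (k * 2)) (⇔.sym (exceptional⇔triplePow2-odd k≢1)))

¬exceptional-4k+2 : ∀ {k} → k ≢ 1 → ¬ Exceptional (2 + k * 2 * 2)
¬exceptional-4k+2 {k} k≢1 =
  k≢1 ∘ triplePow2-odd k ∘ to (triplePow2-*2⇔ (1 + k * 2))
      ∘ to (exceptional⇔triplePow2-even (m*2≢1+n*2 1 k ∘ sym))

¬exceptional-4k+3 : ∀ {k} → k ≢ 0 → k ≢ 1 → ¬ Exceptional (3 + k * 2 * 2)
¬exceptional-4k+3 {k} k≢0 k≢1 =
  k≢1 ∘ triplePow2-odd k ∘ to (triplePow2-*2⇔ (1 + k * 2))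
      ∘ to (exceptional⇔triplePow2-odd (k≢0 ∘ *-cancelʳ-≡ k 0 2 ∘ suc-injective))

¬exceptional-5 : ¬ Exceptional 5
¬exceptional-5 = ¬triplePow2-4 ∘ to (exceptional⇔triplePow2-odd {2} (λ ()))

DefectLaw : ℕ → Set
DefectLaw n = (Exceptional n × Defect n 1) ⊎ (¬ Exceptional n × Defect n 0)

defectLaw-transfer : ∀ {n N} → Exceptional N ⇔ Exceptional n →
                     (∀ {c} → Defect n c → Defect N c) → DefectLaw n → DefectLaw N
defectLaw-transfer N⇔n transfer (inj₁ (e , h))  = inj₁ (from N⇔n e , transfer h)
defectLaw-transfer N⇔n transfer (inj₂ (¬e , h)) = inj₂ (¬e ∘ to N⇔n , transfer h)

data Mod4 : ℕ → Set where
  rem₀ : ∀ m → Mod4 (m * 2 * 2)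
  rem₁ : ∀ m → Mod4 (1 + m * 2 * 2)
  rem₂ : ∀ m → Mod4 (2 + m * 2 * 2)
  rem₃ : ∀ m → Mod4 (3 + m * 2 * 2)

mod4 : ∀ n → Mod4 n
mod4 0 = rem₀ 0
mod4 1 = rem₁ 0
mod4 2 = rem₂ 0
mod4 3 = rem₃ 0
mod4 (suc (suc (suc (suc n)))) with mod4 n
... | rem₀ m = rem₀ (suc m)
... | rem₁ m = rem₁ (suc m)
... | rem₂ m = rem₂ (suc m)
... | rem₃ m = rem₃ (suc m)

defectLaw : ∀ n → 4 ≤ n → DefectLaw n
defectLaw = <-rec (λ n → 4 ≤ n → DefectLaw n) step
  where
  step : ∀ n → (∀ {k} → k < n → 4 ≤ k → DefectLaw k) → 4 ≤ n → DefectLaw n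
  step 1 _ (s≤s ())
  step 2 _ (s≤s (s≤s ()))
  step 3 _ (s≤s (s≤s (s≤s ())))
  step 4 _ _ = inj₁ ((0 , inj₂ refl) , refl)
  step 5 _ _ = inj₂ (¬exceptional-5 , refl)
  step 6 _ _ = inj₁ ((1 , inj₁ refl) , refl)
  step 7 _ _ = inj₁ ((1 , inj₂ refl) , refl)
  step 8 _ _ = inj₂ (¬triplePow2-4 ∘ to (triplePow2-*2⇔ 4)
                                   ∘ to (exceptional⇔triplePow2-even {4} (λ ())) , refl)
  step 9 _ _ = inj₂ (¬exceptional-5 ∘ to (exceptional-4k+1 {2} (λ ())) , refl)
  step 10 _ _ = inj₂ (¬exceptional-4k+2 {2} (λ ()) , refl)
  step 11 _ _ = inj₂ (¬exceptional-4k+3 {2} (λ ()) (λ ()) , refl)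
  step (suc (suc (suc (suc (suc (suc (suc (suc (suc (suc (suc (suc k)))))))))))) ih _
    with mod4 k
  ... | rem₀ m = defectLaw-transfer (exceptional-4k {3 + m} (λ ()) (λ ())) (defect-4k m)
                   (ih (m<m*n (6 + m * 2) 2 (s≤s (s≤s z≤n))) (m≤m+n 4 (2 + m * 2)))
  ... | rem₁ m = defectLaw-transfer (exceptional-4k+1 {3 + m} (λ ())) (defect-4k+1 m)
                   (ih (s≤s (m<m*n (6 + m * 2) 2 (s≤s (s≤s z≤n)))) (m≤m+n 4 (3 + m * 2)))
  ... | rem₂ m = inj₂ (¬exceptional-4k+2 {3 + m} (λ ()) , defect-4k+2 m)
  ... | rem₃ m = inj₂ (¬exceptional-4k+3 {3 + m} (λ ()) (λ ()) , defect-4k+3 m)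

defect-as-ℤ : ∀ {n c} → Defect n c →
              + x n ≡ ((+ x (n ∸ 1) +ℤ + x (n ∸ 2)) -ℤ + x (n ∸ 3)) +ℤ + c
defect-as-ℤ {n} {c} h = rearrange (+ x n) (+ x (n ∸ 3)) (+ x (n ∸ 1)) (+ x (n ∸ 2)) (+ c)
  (begin
    + x n +ℤ + x (n ∸ 3)                 ≡⟨ ℤ.pos-+ (x n) (x (n ∸ 3)) ⟨
    + (x n + x (n ∸ 3))                  ≡⟨ cong +_ h ⟩
    + (x (n ∸ 1) + x (n ∸ 2) + c)        ≡⟨ ℤ.pos-+ (x (n ∸ 1) + x (n ∸ 2)) c ⟩
    + (x (n ∸ 1) + x (n ∸ 2)) +ℤ + c     ≡⟨ cong (_+ℤ + c) (ℤ.pos-+ (x (n ∸ 1)) (x (n ∸ 2))) ⟩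
    + x (n ∸ 1) +ℤ + x (n ∸ 2) +ℤ + c    ∎)
  where
  rearrange : ∀ p d a b c → p +ℤ d ≡ a +ℤ b +ℤ c → p ≡ ((a +ℤ b) -ℤ d) +ℤ c
  rearrange p d a b c h = begin
    p                         ≡⟨ ℤ-Solver.solve (p ∷ d ∷ []) ⟩
    (p +ℤ d) -ℤ d             ≡⟨ cong (_-ℤ d) h ⟩
    (a +ℤ b +ℤ c) -ℤ d        ≡⟨ ℤ-Solver.solve (a ∷ b ∷ c ∷ d ∷ []) ⟩
    ((a +ℤ b) -ℤ d) +ℤ c      ∎

lemma6 : (n : ℕ) → 4 ≤ n →
    ((∃[ i ] (n ≡ 3 * 2 ^ i ⊎ n ≡ 3 * 2 ^ i + 1)) →
      + x n ≡ ((+ x (n ∸ 1) +ℤ + x (n ∸ 2)) -ℤ + x (n ∸ 3)) +ℤ + 1)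
    × ((¬ (∃[ i ] (n ≡ 3 * 2 ^ i ⊎ n ≡ 3 * 2 ^ i + 1))) →
      + x n ≡ (+ x (n ∸ 1) +ℤ + x (n ∸ 2)) -ℤ + x (n ∸ 3))
lemma6 n 4≤n with defectLaw n 4≤n
... | inj₁ (e , h)  = (λ _ → defect-as-ℤ {n} h) , (λ ¬e → contradiction e ¬e)
... | inj₂ (¬e , h) = (λ e → contradiction e ¬e) , (λ _ → trans (defect-as-ℤ {n} h) (ℤ.+-identityʳ _))
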